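{- Let $G$ and $G'$ be directed graphs (loops and multiple arcs allowed) and let $P$ be a polar condition on $G$. Suppose $\delta:G\to G'$ is a surjective graph homomorphism such that (i) for every vertex $v$ of $G$, $\delta$ induces a bijection from the set of arcs of $G$ with origin $v$ to the set of arcs of $G'$ with origin $\delta(v)$; and (ii) for all vertices $v',w'$ of $G'$ with $\deg_{G'}(v',w')\ge1$ and every $w\in\delta^{ -1}(w')$, there exists $v\in\delta^{ -1}(v')$ with $\deg_G(v,w)\ge1$. Then $\delta(P)$ is a polar condition on $G'$.
   Context: For a directed graph $G$ and vertices $v,w$, $\deg_G(v,w)$ is the number of arcs from $v$ to $w$, and for a vertex set $P$, $\deg_G(v,P)=\sum_{w\in P}\deg_G(v,w)$. A vertex subset $P$ is a polar condition on $G$ if for every vertex $v$, $\deg_G(v,P)=1$ implies $v\in P$. A graph homomorphism maps vertices to vertices and arcs to arcs compatibly with origins and destinations. -}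

module Defs where

open import Data.Product using (Σ; ∃; ∃-syntax; _×_; _,_)
open import Relation.Binary.PropositionalEquality using (_≡_)
open import Relation.Unary using (Pred)
open import Level using (0ℓ)

record Digraph : Set₁ where
  field
    V   : Set
    A   : Set
    src : A → V
    tgt : A → V
open Digraph public

VSet : Digraph → Set₁
VSet G = Pred (V G) 0ℓ

DegGe1 : (G : Digraph) → V G → VSet G → Set
DegGe1 G v P = ∃[ e ] (src G e ≡ v × P (tgt G e))

DegEq1 : (G : Digraph) → V G → VSet G → Set
DegEq1 G v P =
  ∃[ e ] ((src G e ≡ v × P (tgt G e)) ×
          (∀ e' → src G e' ≡ v → P (tgt G e') → e' ≡ e))

ArcGe1 : (G : Digraph) → V G → V G → Set
ArcGe1 G v w = ∃[ e ] (src G e ≡ v × tgt G e ≡ w)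

IsPolar : (G : Digraph) → VSet G → Set
IsPolar G P = ∀ v → DegEq1 G v P → P v

record Hom (G H : Digraph) : Set where
  field
    vmap : V G → V H
    amap : A G → A H
    src-comm : ∀ e → src H (amap e) ≡ vmap (src G e)
    tgt-comm : ∀ e → tgt H (amap e) ≡ vmap (tgt G e)
open Hom public

Surjective : {G H : Digraph} → Hom G H → Set
Surjective {G} {H} δ =
  (∀ v' → ∃[ v ] vmap δ v ≡ v') × (∀ a' → ∃[ a ] amap δ a ≡ a')

LocalBij : {G H : Digraph} → Hom G H → Set
LocalBij {G} {H} δ = ∀ v →
  (∀ e₁ e₂ → src G e₁ ≡ v → src G e₂ ≡ v → amap δ e₁ ≡ amap δ e₂ → e₁ ≡ e₂) ×
  (∀ e' → src H e' ≡ vmap δ v → ∃[ e ] (src G e ≡ v × amap δ e ≡ e'))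

Lifting : {G H : Digraph} → Hom G H → Set
Lifting {G} {H} δ = ∀ v' w' → ArcGe1 H v' w' →
  ∀ w → vmap δ w ≡ w' → ∃[ v ] (vmap δ v ≡ v' × ArcGe1 G v w)

Image : {G H : Digraph} → Hom G H → VSet G → VSet H
Image {G} δ P v' = ∃[ v ] (P v × vmap δ v ≡ v')

{-# OPTIONS --safe #-}
module Submission where

-- Lift the unique arc from v' into δ(P) to an arc from some v ∈ δ⁻¹(v') into P,
-- using (ii). Every arc from v into P is sent into δ(P) at δ(v) = v', hence onto
-- that unique arc, so by injectivity in (i) it is the lifted arc: deg_G(v,P) = 1,
-- and polarity of P puts v in P.

open import Defs
open import Data.Product using (∃-syntax; _×_; _,_; proj₁)
open import Relation.Binary.PropositionalEquality using (_≡_; refl; sym; trans; cong; subst)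

module _ {G G' : Digraph} (δ : Hom G G') where

  LocallyInjectiveAt : V G → Set
  LocallyInjectiveAt v =
    ∀ e₁ e₂ → src G e₁ ≡ v → src G e₂ ≡ v → amap δ e₁ ≡ amap δ e₂ → e₁ ≡ e₂

  amap-arcInto-Image : ∀ {v} (P : VSet G) (e : A G) → src G e ≡ v → P (tgt G e) →
    src G' (amap δ e) ≡ vmap δ v × Image δ P (tgt G' (amap δ e))
  amap-arcInto-Image P e src≡v Ptgt =
    trans (src-comm δ e) (cong (vmap δ) src≡v) , (tgt G e , Ptgt , sym (tgt-comm δ e))

  lift-DegGe1 : Lifting δ → ∀ (P : VSet G) v' → DegGe1 G' v' (Image δ P) →
    ∃[ v ] (vmap δ v ≡ v' × DegGe1 G v P)
  lift-DegGe1 lift P v' (e' , src≡v' , (w , Pw , δw≡)) with lift v' (tgt G' e') (e' , src≡v' , refl) w δw≡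
  ... | v , δv≡v' , (e , src≡v , tgt≡w) = v , δv≡v' , (e , src≡v , subst P (sym tgt≡w) Pw)

  reflect-DegEq1 : ∀ (P : VSet G) v → LocallyInjectiveAt v →
    DegEq1 G' (vmap δ v) (Image δ P) → DegGe1 G v P → DegEq1 G v P
  reflect-DegEq1 P v inj (e' , _ , unique') (e , src≡v , Ptgt) =
    e , (src≡v , Ptgt) , λ f srcf≡v Ptgtf →
      inj f e srcf≡v src≡v (trans (onto-e' f srcf≡v Ptgtf) (sym (onto-e' e src≡v Ptgt)))
    where
      onto-e' : ∀ f → src G f ≡ v → P (tgt G f) → amap δ f ≡ e'
      onto-e' f srcf≡v Ptgtf with amap-arcInto-Image P f srcf≡v Ptgtf
      ... | src≡ , inImage = unique' (amap δ f) src≡ inImage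

lemma2p4 : (G G' : Digraph) (P : VSet G) → IsPolar G P →
    (δ : Hom G G') → Surjective δ → LocalBij δ → Lifting δ →
    IsPolar G' (Image δ P)
lemma2p4 G G' P polar δ _ localBij lift v' degEq1@(e' , arcInto , _)
  with lift-DegGe1 δ lift P v' (e' , arcInto)
... | v , refl , degGe1 =
  v , polar v (reflect-DegEq1 δ P v (proj₁ (localBij v)) degEq1 degGe1) , refl
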